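{- Let $S$ and $T$ be rooted binary trees on the vertex set $\{1,\dots,n\}$, each labeled in infix order. Let $L_S, L_T$ be their numbers of maximal left chains. Then $C(S,T) \ge |L_S - L_T|$.
   Context: Trees are rooted binary trees whose $n$ vertices are identified with $1,\dots,n$ in infix (in-order) order. A subtree rooted at $x$ is $x$ together with all its descendants. A left chain $[u$-$v]$ is a nonempty sequence of vertices $u=x_1,\dots,x_k=v$ with $x_{i+1}$ the left child of $x_i$; a single vertex is a chain. A maximal left chain is a left chain not contained in any other left chain. Right chains are defined symmetrically. A direct c-rotation $\mathrm{rot}([u$-$v],w)$ applies when $[u$-$v]$ is a left chain (not necessarily maximal) and $u$ is the right child of $w$. Its effect: (i) $u$ takes the place of $w$ (as the child of $w$'s former parent on the same side, or as the root); (ii) $w$ becomes the left child of $v$; (iii) the former left subtree of $v$, if any, becomes the right subtree of $w$ (else $w$'s right child is empty). An inverse c-rotation $\mathrm{rot}(w,[u$-$v])$ applies when $[u$-$v]$ is a left chain and $w$ is the left child of $v$. Its effect: (i) $w$ takes the place of $u$; (ii) $u$ becomes the right child of $w$; (iii) the former right subtree of $w$, if any, becomes the left subtree of $v$ (else $v$'s left child is empty). The mirror-image operations for right chains (interchanging left and right) are also c-rotations. All other pointers are unchanged by a c-rotation. The chain distance $C(S,T)$ is the minimum number of c-rotations needed to transform $S$ into $T$. -}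

module Defs where

open import Data.Nat using (ℕ; zero; suc; _+_)
open import Data.List using (List; []; _∷_; _++_; foldl)

-- Rooted binary trees (possibly empty). A tree's vertices are identified
-- with 1..n in infix (in-order) order, so labels are implicit: the vertex
-- set is determined by the shape.
data Tree : Set where
  leaf : Tree
  node : Tree → Tree → Tree        -- node left right

size : Tree → ℕ
size leaf = 0
size (node l r) = size l + suc (size r)

-- Maximal left chains, listed explicitly as lists of vertex labels
-- (top to bottom).  'chainsFrom o t' lists the maximal left chains of t,
-- whose vertices are labelled o+1 .. o+size t; when t is nonempty the
-- first chain in the list is the one containing the root of t.

extendChain : ℕ → List (List ℕ) → List (List ℕ)
extendChain x [] = (x ∷ []) ∷ []
extendChain x (c ∷ cs) = (x ∷ c) ∷ cs

chainsFrom : ℕ → Tree → List (List ℕ)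
chainsFrom o leaf = []
chainsFrom o (node l r) =
  extendChain (o + suc (size l)) (chainsFrom o l)
  ++ chainsFrom (o + suc (size l)) r

maxLeftChains : Tree → List (List ℕ)
maxLeftChains = chainsFrom 0

numMaxLeftChains : Tree → ℕ
numMaxLeftChains t = Data.List.length (maxLeftChains t)
  where import Data.List

-- Left / right chains as tree contexts.
-- lchain X R Rs : a left chain u = x_1, ..., x_k = v (k = 1 + length Rs)
-- where v has left subtree X and right subtree R, and the vertices above v
-- (going up to u) have right subtrees Rs (listed bottom to top).
lchain : Tree → Tree → List Tree → Tree
lchain X R Rs = foldl (λ t r → node t r) (node X R) Rs

-- rchain X L Ls : mirror image: a right chain u .. v where v has right
-- subtree X and left subtree L, and the vertices above v have left
-- subtrees Ls (bottom to top).
rchain : Tree → Tree → List Tree → Tree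
rchain X L Ls = foldl (λ t l → node l t) (node L X) Ls

data CRot : Tree → Tree → Set where
  -- direct c-rotation rot([u-v], w): w has left subtree A and right child u
  dirL : ∀ A X R Rs → CRot (node A (lchain X R Rs)) (lchain (node A X) R Rs)
  -- inverse c-rotation rot(w, [u-v]): w is the left child of v
  invL : ∀ A X R Rs → CRot (lchain (node A X) R Rs) (node A (lchain X R Rs))
  dirR : ∀ B X L Ls → CRot (node (rchain X L Ls) B) (rchain (node X B) L Ls)
  invR : ∀ B X L Ls → CRot (rchain (node X B) L Ls) (node (rchain X L Ls) B)
  inL  : ∀ {l l'} r → CRot l l' → CRot (node l r) (node l' r)
  inR  : ∀ l {r r'} → CRot r r' → CRot (node l r) (node l r')

data CRots : ℕ → Tree → Tree → Set where
  done : ∀ {S} → CRots zero S S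
  step : ∀ {k S S' T} → CRot S S' → CRots k S' T → CRots (suc k) S T

-- The number of maximal left chains of node l r is
-- max 1 L(l) + L(r): the root continues the chain through the root of l,
-- or starts a new one when l is empty. For each of the four basic
-- c-rotations, expanding the count along the chain shows the two sides
-- differ only in one summand, L(X) versus max 1 L(X), where X is the
-- subtree that is moved; so one c-rotation changes the count by at most 1,
-- also inside a context since max 1 is non-expansive. The bound for k
-- rotations follows by the triangle inequality.
module Submission where

open import Defs
open import Data.Nat using (ℕ; _≤_; ∣_-_∣)
open import Relation.Binary.PropositionalEquality using (_≡_)

open import Data.Nat using (zero; suc; pred; _+_)
open import Data.Nat.Properties
open import Data.List using ([]; _∷_; _++_; length; map)
open import Data.Nat.ListAction using (sum)
open import Data.List.Properties using (length-++)
open import Relation.Binary.PropositionalEquality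
  using (refl; sym; cong; cong₂; subst; subst₂; module ≡-Reasoning)

-- max 1 n, written so that atLeast1 (suc m) reduces to suc m.
atLeast1 : ℕ → ℕ
atLeast1 n = suc (pred n)

leftChainCount : Tree → ℕ
leftChainCount leaf = 0
leftChainCount (node l r) = atLeast1 (leftChainCount l) + leftChainCount r

length-extendChain : ∀ x cs → length (extendChain x cs) ≡ atLeast1 (length cs)
length-extendChain x []       = refl
length-extendChain x (c ∷ cs) = refl

length-chainsFrom : ∀ o t → length (chainsFrom o t) ≡ leftChainCount t
length-chainsFrom o leaf = refl
length-chainsFrom o (node l r) = begin
  length (extendChain x (chainsFrom o l) ++ chainsFrom x r)
    ≡⟨ length-++ (extendChain x (chainsFrom o l)) ⟩
  length (extendChain x (chainsFrom o l)) + length (chainsFrom x r)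
    ≡⟨ cong₂ _+_ (length-extendChain x (chainsFrom o l)) (length-chainsFrom x r) ⟩
  atLeast1 (length (chainsFrom o l)) + leftChainCount r
    ≡⟨ cong (λ n → atLeast1 n + leftChainCount r) (length-chainsFrom o l) ⟩
  leftChainCount (node l r) ∎
  where
  open ≡-Reasoning
  x = o + suc (size l)

numMaxLeftChains≡leftChainCount : ∀ t → numMaxLeftChains t ≡ leftChainCount t
numMaxLeftChains≡leftChainCount = length-chainsFrom 0

leftChainCount-lchain : ∀ X R Rs →
  leftChainCount (lchain X R Rs) ≡ leftChainCount (node X R) + sum (map leftChainCount Rs)
leftChainCount-lchain X R [] = sym (+-identityʳ _)
leftChainCount-lchain X R (r ∷ Rs) = begin
  leftChainCount (lchain (node X R) r Rs)
    ≡⟨ leftChainCount-lchain (node X R) r Rs ⟩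
  leftChainCount (node X R) + leftChainCount r + sum (map leftChainCount Rs)
    ≡⟨ +-assoc (leftChainCount (node X R)) (leftChainCount r) _ ⟩
  leftChainCount (node X R) + sum (map leftChainCount (r ∷ Rs)) ∎
  where open ≡-Reasoning

leftChainCount-rchain : ∀ X L Ls →
  leftChainCount (rchain X L Ls) ≡
  leftChainCount (node L X) + sum (map (λ t → atLeast1 (leftChainCount t)) Ls)
leftChainCount-rchain X L [] = sym (+-identityʳ _)
leftChainCount-rchain X L (l ∷ Ls) = begin
  leftChainCount (rchain (node L X) l Ls)
    ≡⟨ leftChainCount-rchain (node L X) l Ls ⟩
  (a + c) + s        ≡⟨ cong (_+ s) (+-comm a c) ⟩
  (c + a) + s        ≡⟨ +-assoc c a s ⟩
  c + (a + s)        ∎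
  where
  open ≡-Reasoning
  a = atLeast1 (leftChainCount l)
  c = leftChainCount (node L X)
  s = sum (map (λ t → atLeast1 (leftChainCount t)) Ls)

∣m+o-n+o∣≡∣m-n∣ : ∀ m n o → ∣ m + o - n + o ∣ ≡ ∣ m - n ∣
∣m+o-n+o∣≡∣m-n∣ m n o = begin
  ∣ m + o - n + o ∣  ≡⟨ cong₂ ∣_-_∣ (+-comm m o) (+-comm n o) ⟩
  ∣ o + m - o + n ∣  ≡⟨ ∣m+n-m+o∣≡∣n-o∣ o m n ⟩
  ∣ m - n ∣          ∎
  where open ≡-Reasoning

∣m-n∣≤c⇒∣n-m∣≤c : ∀ m n {c} → ∣ m - n ∣ ≤ c → ∣ n - m ∣ ≤ c
∣m-n∣≤c⇒∣n-m∣≤c m n {c} = subst (_≤ c) (∣-∣-comm m n)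

∣atLeast1[n]-n∣≤1 : ∀ n → ∣ atLeast1 n - n ∣ ≤ 1
∣atLeast1[n]-n∣≤1 zero    = ≤-refl
∣atLeast1[n]-n∣≤1 (suc n) = m≤n⇒m≤1+n (≤-reflexive (∣n-n∣≡0 n))

atLeast1-nonExpansive : ∀ m n → ∣ atLeast1 m - atLeast1 n ∣ ≤ ∣ m - n ∣
atLeast1-nonExpansive zero    zero    = ≤-refl
atLeast1-nonExpansive zero    (suc n) = n≤1+n n
atLeast1-nonExpansive (suc m) zero    = ≤-trans (≤-reflexive (∣-∣-identityʳ m)) (n≤1+n m)
atLeast1-nonExpansive (suc m) (suc n) = ≤-refl

∣p+[atLeast1[n]+q]-p+[n+q]∣≤1 : ∀ p n q → ∣ p + (atLeast1 n + q) - p + (n + q) ∣ ≤ 1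
∣p+[atLeast1[n]+q]-p+[n+q]∣≤1 p n q = begin
  ∣ p + (atLeast1 n + q) - p + (n + q) ∣  ≡⟨ ∣m+n-m+o∣≡∣n-o∣ p _ _ ⟩
  ∣ atLeast1 n + q - n + q ∣              ≡⟨ ∣m+o-n+o∣≡∣m-n∣ (atLeast1 n) n q ⟩
  ∣ atLeast1 n - n ∣                      ≤⟨ ∣atLeast1[n]-n∣≤1 n ⟩
  1                                       ∎
  where open ≤-Reasoning

∣dirL∣≤1 : ∀ A X R Rs →
  ∣ leftChainCount (node A (lchain X R Rs)) - leftChainCount (lchain (node A X) R Rs) ∣ ≤ 1
∣dirL∣≤1 A X R Rs = subst₂ (λ m n → ∣ m - n ∣ ≤ 1) (sym before) (sym after)
  (∣p+[atLeast1[n]+q]-p+[n+q]∣≤1 a x (r + s))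
  where
  open ≡-Reasoning
  a = atLeast1 (leftChainCount A)
  x = leftChainCount X
  r = leftChainCount R
  s = sum (map leftChainCount Rs)
  before : leftChainCount (node A (lchain X R Rs)) ≡ a + (atLeast1 x + (r + s))
  before = begin
    a + leftChainCount (lchain X R Rs) ≡⟨ cong (a +_) (leftChainCount-lchain X R Rs) ⟩
    a + (atLeast1 x + r + s)           ≡⟨ cong (a +_) (+-assoc (atLeast1 x) r s) ⟩
    a + (atLeast1 x + (r + s))         ∎
  after : leftChainCount (lchain (node A X) R Rs) ≡ a + (x + (r + s))
  after = begin
    leftChainCount (lchain (node A X) R Rs) ≡⟨ leftChainCount-lchain (node A X) R Rs ⟩
    a + x + r + s                           ≡⟨ +-assoc (a + x) r s ⟩
    a + x + (r + s)                         ≡⟨ +-assoc a x (r + s) ⟩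
    a + (x + (r + s))                       ∎

∣dirR∣≤1 : ∀ B X L Ls →
  ∣ leftChainCount (node (rchain X L Ls) B) - leftChainCount (rchain (node X B) L Ls) ∣ ≤ 1
∣dirR∣≤1 B X L Ls = subst₂ (λ m n → ∣ m - n ∣ ≤ 1) (sym before) (sym after)
  (∣m-n∣≤c⇒∣n-m∣≤c (l + (atLeast1 x + (b + s))) (l + (x + (b + s)))
    (∣p+[atLeast1[n]+q]-p+[n+q]∣≤1 l x (b + s)))
  where
  open ≡-Reasoning
  l = atLeast1 (leftChainCount L)
  x = leftChainCount X
  b = leftChainCount B
  s = sum (map (λ t → atLeast1 (leftChainCount t)) Ls)
  -- the rchain is nonempty, so atLeast1 of its count computes away once the count is expanded
  before : leftChainCount (node (rchain X L Ls) B) ≡ l + (x + (b + s))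
  before = begin
    atLeast1 (leftChainCount (rchain X L Ls)) + b
      ≡⟨ cong (λ n → atLeast1 n + b) (leftChainCount-rchain X L Ls) ⟩
    l + x + s + b           ≡⟨ +-assoc (l + x) s b ⟩
    l + x + (s + b)         ≡⟨ cong (l + x +_) (+-comm s b) ⟩
    l + x + (b + s)         ≡⟨ +-assoc l x (b + s) ⟩
    l + (x + (b + s))       ∎
  after : leftChainCount (rchain (node X B) L Ls) ≡ l + (atLeast1 x + (b + s))
  after = begin
    leftChainCount (rchain (node X B) L Ls) ≡⟨ leftChainCount-rchain (node X B) L Ls ⟩
    l + (atLeast1 x + b) + s                ≡⟨ +-assoc l (atLeast1 x + b) s ⟩
    l + (atLeast1 x + b + s)                ≡⟨ cong (l +_) (+-assoc (atLeast1 x) b s) ⟩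
    l + (atLeast1 x + (b + s))              ∎

crot⇒∣Δcount∣≤1 : ∀ {S T} → CRot S T → ∣ leftChainCount S - leftChainCount T ∣ ≤ 1
crot⇒∣Δcount∣≤1 (dirL A X R Rs) = ∣dirL∣≤1 A X R Rs
crot⇒∣Δcount∣≤1 {S} {T} (invL A X R Rs) =
  ∣m-n∣≤c⇒∣n-m∣≤c (leftChainCount T) (leftChainCount S) (∣dirL∣≤1 A X R Rs)
crot⇒∣Δcount∣≤1 (dirR B X L Ls) = ∣dirR∣≤1 B X L Ls
crot⇒∣Δcount∣≤1 {S} {T} (invR B X L Ls) =
  ∣m-n∣≤c⇒∣n-m∣≤c (leftChainCount T) (leftChainCount S) (∣dirR∣≤1 B X L Ls)
crot⇒∣Δcount∣≤1 (inL {l} {l'} r rot) = begin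
  ∣ atLeast1 m + c - atLeast1 m' + c ∣  ≡⟨ ∣m+o-n+o∣≡∣m-n∣ (atLeast1 m) (atLeast1 m') c ⟩
  ∣ atLeast1 m - atLeast1 m' ∣          ≤⟨ atLeast1-nonExpansive m m' ⟩
  ∣ m - m' ∣                            ≤⟨ crot⇒∣Δcount∣≤1 rot ⟩
  1                                     ∎
  where
  open ≤-Reasoning
  m  = leftChainCount l
  m' = leftChainCount l'
  c  = leftChainCount r
crot⇒∣Δcount∣≤1 (inR l rot) =
  subst (_≤ 1) (sym (∣m+n-m+o∣≡∣n-o∣ (atLeast1 (leftChainCount l)) _ _)) (crot⇒∣Δcount∣≤1 rot)

crots⇒∣Δcount∣≤k : ∀ {k S T} → CRots k S T → ∣ leftChainCount S - leftChainCount T ∣ ≤ k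
crots⇒∣Δcount∣≤k {S = S} done = ≤-reflexive (∣n-n∣≡0 (leftChainCount S))
crots⇒∣Δcount∣≤k {S = S} {T} (step {S' = S'} rot rots) =
  ≤-trans (∣-∣-triangle (leftChainCount S) (leftChainCount S') (leftChainCount T))
    (+-mono-≤ (crot⇒∣Δcount∣≤1 rot) (crots⇒∣Δcount∣≤k rots))

proposition5 : (n : ℕ) (S T : Tree) → size S ≡ n → size T ≡ n →
    (k : ℕ) → CRots k S T →
    ∣ numMaxLeftChains S - numMaxLeftChains T ∣ ≤ k
proposition5 _ S T _ _ _ rots =
  subst₂ (λ m n → ∣ m - n ∣ ≤ _)
    (sym (numMaxLeftChains≡leftChainCount S)) (sym (numMaxLeftChains≡leftChainCount T))
    (crots⇒∣Δcount∣≤k rots)
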